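{- Let $n\ge1$ and let $A_1,A_2,A_3,A_4$ be pairwise distinct nonempty subsets of $[n]$ such that $\chi_{A_1}+\chi_{A_3}=\chi_{A_2}+\chi_{A_4}$, $A_i\cap A_j\ne\emptyset$ for $1\le i<j\le 3$, and $H_{A_4}$ is the largest of the four hyperplanes $H_{A_1},\dots,H_{A_4}$ in the binary order. Define $M=\bigcap_{i=1}^4A_i$ and $S_i=(A_i\cap A_{i+1})\setminus M$ for $1\le i\le4$ (indices mod 4, so $A_5=A_1$). Then: (S1) $S_i\cap S_j=\emptyset$ for all $i\ne j$ (in particular $S_i\neq S_j$ for $i\ne j$); (S2) $M\cap S_i=\emptyset$ for all $1\le i\le4$; (S3) $M\ne\emptyset$; (S4) at most one of two opposite sides is empty, i.e. not both $S_1=S_3=\emptyset$ and not both $S_2=S_4=\emptyset$.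
   Context: $\chi_A\in\{0,1\}^n$ is the characteristic vector of $A\subseteq[n]$ and $H_A=\{x\in\mathbb{R}^n:\sum_{i\in A}x_i=0\}$. Binary order: $H_I<H_J$ iff $\sum_{i\in I}2^i<\sum_{j\in J}2^j$. -}

module Defs where

open import Data.Nat using (ℕ; zero; suc; _+_; _*_; _^_)
open import Data.Bool using (Bool; true; false)

bit : Bool → ℕ
bit true  = 1
bit false = 0
open import Data.Fin using (Fin; zero; suc; toℕ)
open import Data.Vec using (Vec; []; _∷_; lookup)
open import Data.Fin.Subset using (Subset; _∩_; _─_)

-- Ground set [n] is modelled as Fin n (element k+1 of [n] ↦ k : Fin n).

χ : ∀ {n} → Subset n → Fin n → ℕ
χ A i = bit (lookup A i)

-- binary weight  Σ_{i ∈ A} 2^i  (element with index k contributes 2^k);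
-- defines the binary order: H_I < H_J iff weight I < weight J.
-- (Shifting exponents by one, i.e. using [n] = {1..n}, does not change the order.)
weight : ∀ {n} → Subset n → ℕ
weight []          = 0
weight (b ∷ A)     = bit b + 2 * weight A

next : Fin 4 → Fin 4
next zero                   = suc zero
next (suc zero)             = suc (suc zero)
next (suc (suc zero))       = suc (suc (suc zero))
next (suc (suc (suc zero))) = zero

M : ∀ {n} → (Fin 4 → Subset n) → Subset n
M A = A zero ∩ A (suc zero) ∩ A (suc (suc zero)) ∩ A (suc (suc (suc zero)))

S : ∀ {n} → (Fin 4 → Subset n) → Fin 4 → Subset n
S A i = (A i ∩ A (next i)) ─ M A

module Submission where

-- Indexing the sets from 0 as in Fin 4: since χ_{A₀} + χ_{A₂} = χ_{A₁} + χ_{A₃}, every element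
-- lies in none of the Aᵢ, in all of them, or in exactly two cyclically consecutive ones Aᵢ, Aᵢ₊₁,
-- that is, exactly in Sᵢ. Hence the Sᵢ are pairwise disjoint and disjoint from M, every element of
-- A₀ ∩ A₂ lies in M, and S₀ = S₂ = ∅ (resp. S₁ = S₃ = ∅) would leave no element telling A₀ from A₃
-- (resp. A₁). Besides the χ relation, only A₀ ∩ A₂ ≠ ∅ and A₀ ∉ {A₁, A₃} are used.

open import Defs
open import Data.Nat using (ℕ; _≥_; _<_; _+_)
open import Data.Bool using (Bool; true; false; _∧_; not)
open import Data.Bool.Properties using (¬-not)
open import Data.Fin using (Fin; zero; suc)
open import Data.Fin.Subset using (Subset; _∩_; _─_; Nonempty; Empty; _∈_; _∉_)
open import Data.Fin.Subset.Properties using (x∈p∩q⁻)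
open import Data.Vec using (Vec; []; _∷_; lookup; tabulate; replicate)
open import Data.Vec.Properties
  using (lookup-zipWith; lookup-replicate; lookup∘tabulate; tabulate∘lookup; tabulate-cong;
         []=⇒lookup; lookup⇒[]=)
open import Data.Product using (_×_; _,_)
open import Function using (_∘_)
open import Relation.Nullary using (¬_)
open import Relation.Binary.PropositionalEquality
  using (_≡_; _≢_; refl; sym; trans; cong; cong₂; module ≡-Reasoning)

private
  variable
    n : ℕ

lookup-∩ : (p q : Subset n) (x : Fin n) → lookup (p ∩ q) x ≡ lookup p x ∧ lookup q x
lookup-∩ p q x = lookup-zipWith _∧_ x p q

lookup-─ : (p q : Subset n) (x : Fin n) → lookup (p ─ q) x ≡ not (lookup q x) ∧ lookup p x
lookup-─ (_ ∷ _) (true  ∷ _) zero    = refl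
lookup-─ (_ ∷ _) (false ∷ _) zero    = refl
lookup-─ (_ ∷ p) (_     ∷ q) (suc x) = lookup-─ p q x

x∈p─q⇒x∉q : {p q : Subset n} {x : Fin n} → x ∈ p ─ q → x ∉ q
x∈p─q⇒x∉q {p = p} {q} {x} x∈p─q x∈q = true≢false (begin
  true                          ≡⟨ sym ([]=⇒lookup x∈p─q) ⟩
  lookup (p ─ q) x              ≡⟨ lookup-─ p q x ⟩
  not (lookup q x) ∧ lookup p x ≡⟨ cong (λ b → not b ∧ lookup p x) ([]=⇒lookup x∈q) ⟩
  false                         ∎)
  where
  open ≡-Reasoning
  true≢false : true ≢ false
  true≢false ()

x∉p⇒lookup≡false : {p : Subset n} {x : Fin n} → x ∉ p → lookup p x ≡ false
x∉p⇒lookup≡false {p = p} {x} x∉p = ¬-not (x∉p ∘ lookup⇒[]= x p)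

subset-ext : {p q : Subset n} → (∀ x → lookup p x ≡ lookup q x) → p ≡ q
subset-ext {p = p} {q} eq = trans (sym (tabulate∘lookup p)) (trans (tabulate-cong eq) (tabulate∘lookup q))

Column : Set
Column = Vec Bool 4

column : (Fin 4 → Subset n) → Fin n → Column
column A x = tabulate λ i → lookup (A i) x

inAll : Column → Bool
inAll (a ∷ b ∷ c ∷ d ∷ []) = a ∧ (b ∧ (c ∧ d))

onSide : Column → Fin 4 → Bool
onSide c i = not (inAll c) ∧ (lookup c i ∧ lookup c (next i))

sideColumn : Fin 4 → Column
sideColumn zero                   = true  ∷ true  ∷ false ∷ false ∷ []
sideColumn (suc zero)             = false ∷ true  ∷ true  ∷ false ∷ []
sideColumn (suc (suc zero))       = false ∷ false ∷ true  ∷ true  ∷ []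
sideColumn (suc (suc (suc zero))) = true  ∷ false ∷ false ∷ true  ∷ []

data Balanced : Column → Set where
  none : Balanced (false ∷ false ∷ false ∷ false ∷ [])
  all  : Balanced (true  ∷ true  ∷ true  ∷ true  ∷ [])
  side : ∀ i → Balanced (sideColumn i)

balanced : (c : Column) →
  bit (lookup c zero) + bit (lookup c (suc (suc zero)))
    ≡ bit (lookup c (suc zero)) + bit (lookup c (suc (suc (suc zero)))) →
  Balanced c
balanced (false ∷ false ∷ false ∷ false ∷ []) _ = none
balanced (false ∷ false ∷ false ∷ true  ∷ []) ()
balanced (false ∷ false ∷ true  ∷ false ∷ []) ()
balanced (false ∷ false ∷ true  ∷ true  ∷ []) _ = side (suc (suc zero))
balanced (false ∷ true  ∷ false ∷ false ∷ []) ()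
balanced (false ∷ true  ∷ false ∷ true  ∷ []) ()
balanced (false ∷ true  ∷ true  ∷ false ∷ []) _ = side (suc zero)
balanced (false ∷ true  ∷ true  ∷ true  ∷ []) ()
balanced (true  ∷ false ∷ false ∷ false ∷ []) ()
balanced (true  ∷ false ∷ false ∷ true  ∷ []) _ = side (suc (suc (suc zero)))
balanced (true  ∷ false ∷ true  ∷ false ∷ []) ()
balanced (true  ∷ false ∷ true  ∷ true  ∷ []) ()
balanced (true  ∷ true  ∷ false ∷ false ∷ []) _ = side zero
balanced (true  ∷ true  ∷ false ∷ true  ∷ []) ()
balanced (true  ∷ true  ∷ true  ∷ false ∷ []) ()
balanced (true  ∷ true  ∷ true  ∷ true  ∷ []) _ = all

onSide-sideColumn : ∀ k i → onSide (sideColumn k) i ≡ true → i ≡ k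
onSide-sideColumn zero                   zero                   _ = refl
onSide-sideColumn zero                   (suc zero)             ()
onSide-sideColumn zero                   (suc (suc zero))       ()
onSide-sideColumn zero                   (suc (suc (suc zero))) ()
onSide-sideColumn (suc zero)             zero                   ()
onSide-sideColumn (suc zero)             (suc zero)             _ = refl
onSide-sideColumn (suc zero)             (suc (suc zero))       ()
onSide-sideColumn (suc zero)             (suc (suc (suc zero))) ()
onSide-sideColumn (suc (suc zero))       zero                   ()
onSide-sideColumn (suc (suc zero))       (suc zero)             ()
onSide-sideColumn (suc (suc zero))       (suc (suc zero))       _ = refl
onSide-sideColumn (suc (suc zero))       (suc (suc (suc zero))) ()
onSide-sideColumn (suc (suc (suc zero))) zero                   ()
onSide-sideColumn (suc (suc (suc zero))) (suc zero)             ()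
onSide-sideColumn (suc (suc (suc zero))) (suc (suc zero))       ()
onSide-sideColumn (suc (suc (suc zero))) (suc (suc (suc zero))) _ = refl

onSide-unique : ∀ {c i j} → Balanced c → onSide c i ≡ true → onSide c j ≡ true → i ≡ j
onSide-unique {i = i} none p _ with () ← trans (sym p) (cong (_∧ lookup (replicate 4 false) (next i)) (lookup-replicate i false))
onSide-unique all () _
onSide-unique (side k) p q = trans (onSide-sideColumn k _ p) (sym (onSide-sideColumn k _ q))

inAll-opposite : ∀ {c} → Balanced c →
  lookup c zero ≡ true → lookup c (suc (suc zero)) ≡ true → inAll c ≡ true
inAll-opposite all                             _ _  = refl
inAll-opposite (side zero)                     _ ()
inAll-opposite (side (suc zero))               ()
inAll-opposite (side (suc (suc zero)))         ()
inAll-opposite (side (suc (suc (suc zero))))   _ ()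

offSides₀₂⇒lookup₀≡lookup₃ : ∀ {c} → Balanced c →
  onSide c zero ≡ false → onSide c (suc (suc zero)) ≡ false →
  lookup c zero ≡ lookup c (suc (suc (suc zero)))
offSides₀₂⇒lookup₀≡lookup₃ none                           _  _  = refl
offSides₀₂⇒lookup₀≡lookup₃ all                            _  _  = refl
offSides₀₂⇒lookup₀≡lookup₃ (side zero)                    () _
offSides₀₂⇒lookup₀≡lookup₃ (side (suc zero))              _  _  = refl
offSides₀₂⇒lookup₀≡lookup₃ (side (suc (suc zero)))        _  ()
offSides₀₂⇒lookup₀≡lookup₃ (side (suc (suc (suc zero))))  _  _  = refl

offSides₁₃⇒lookup₀≡lookup₁ : ∀ {c} → Balanced c →
  onSide c (suc zero) ≡ false → onSide c (suc (suc (suc zero))) ≡ false →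
  lookup c zero ≡ lookup c (suc zero)
offSides₁₃⇒lookup₀≡lookup₁ none                           _  _  = refl
offSides₁₃⇒lookup₀≡lookup₁ all                            _  _  = refl
offSides₁₃⇒lookup₀≡lookup₁ (side zero)                    _  _  = refl
offSides₁₃⇒lookup₀≡lookup₁ (side (suc zero))              () _
offSides₁₃⇒lookup₀≡lookup₁ (side (suc (suc zero)))        _  _  = refl
offSides₁₃⇒lookup₀≡lookup₁ (side (suc (suc (suc zero))))  _  ()

module _ (A : Fin 4 → Subset n) where

  lookup-M : ∀ x → lookup (M A) x ≡ inAll (column A x)
  lookup-M x = begin
    lookup (A zero ∩ A (suc zero) ∩ A (suc (suc zero)) ∩ A (suc (suc (suc zero)))) x
      ≡⟨ lookup-∩ (A zero) _ x ⟩
    lookup (A zero) x ∧ lookup (A (suc zero) ∩ A (suc (suc zero)) ∩ A (suc (suc (suc zero)))) x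
      ≡⟨ cong (lookup (A zero) x ∧_) (lookup-∩ (A (suc zero)) _ x) ⟩
    lookup (A zero) x ∧ (lookup (A (suc zero)) x ∧ lookup (A (suc (suc zero)) ∩ A (suc (suc (suc zero)))) x)
      ≡⟨ cong (λ b → lookup (A zero) x ∧ (lookup (A (suc zero)) x ∧ b)) (lookup-∩ (A (suc (suc zero))) _ x) ⟩
    inAll (column A x) ∎
    where open ≡-Reasoning

  lookup-S : ∀ i x → lookup (S A i) x ≡ onSide (column A x) i
  lookup-S i x = begin
    lookup ((A i ∩ A (next i)) ─ M A) x
      ≡⟨ lookup-─ (A i ∩ A (next i)) (M A) x ⟩
    not (lookup (M A) x) ∧ lookup (A i ∩ A (next i)) x
      ≡⟨ cong₂ (λ m s → not m ∧ s) (lookup-M x) (lookup-∩ (A i) (A (next i)) x) ⟩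
    not (inAll c) ∧ (lookup (A i) x ∧ lookup (A (next i)) x)
      ≡⟨ cong₂ (λ a b → not (inAll c) ∧ (a ∧ b)) (sym (lookup∘tabulate f i)) (sym (lookup∘tabulate f (next i))) ⟩
    onSide c i ∎
    where
    open ≡-Reasoning
    f : Fin 4 → Bool
    f k = lookup (A k) x
    c : Column
    c = column A x

  M-disjoint-S : ∀ i → Empty (M A ∩ S A i)
  M-disjoint-S i (x , x∈M∩S) with x∈M , x∈S ← x∈p∩q⁻ (M A) (S A i) x∈M∩S = x∈p─q⇒x∉q x∈S x∈M

  module _ (balance : ∀ x → Balanced (column A x)) where

    S-disjoint : ∀ {i j} → i ≢ j → Empty (S A i ∩ S A j)
    S-disjoint {i} {j} i≢j (x , x∈Sᵢ∩Sⱼ) with x∈Sᵢ , x∈Sⱼ ← x∈p∩q⁻ (S A i) (S A j) x∈Sᵢ∩Sⱼ =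
      i≢j (onSide-unique (balance x) (onSide⁺ x∈Sᵢ) (onSide⁺ x∈Sⱼ))
      where
      onSide⁺ : ∀ {k} → x ∈ S A k → onSide (column A x) k ≡ true
      onSide⁺ {k} x∈Sₖ = trans (sym (lookup-S k x)) ([]=⇒lookup x∈Sₖ)

    M-nonempty : Nonempty (A zero ∩ A (suc (suc zero))) → Nonempty (M A)
    M-nonempty (x , x∈A₀∩A₂) with x∈A₀ , x∈A₂ ← x∈p∩q⁻ (A zero) (A (suc (suc zero))) x∈A₀∩A₂ =
      x , lookup⇒[]= x (M A)
            (trans (lookup-M x) (inAll-opposite (balance x) ([]=⇒lookup x∈A₀) ([]=⇒lookup x∈A₂)))

    emptySide⇒offSide : ∀ {i} → Empty (S A i) → ∀ x → onSide (column A x) i ≡ false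
    emptySide⇒offSide {i} Sᵢ≡∅ x = trans (sym (lookup-S i x)) (x∉p⇒lookup≡false (Sᵢ≡∅ ∘ (x ,_)))

    emptySides₀₂⇒A₀≡A₃ : Empty (S A zero) → Empty (S A (suc (suc zero))) → A zero ≡ A (suc (suc (suc zero)))
    emptySides₀₂⇒A₀≡A₃ S₀≡∅ S₂≡∅ = subset-ext λ x →
      offSides₀₂⇒lookup₀≡lookup₃ (balance x) (emptySide⇒offSide S₀≡∅ x) (emptySide⇒offSide S₂≡∅ x)

    emptySides₁₃⇒A₀≡A₁ : Empty (S A (suc zero)) → Empty (S A (suc (suc (suc zero)))) → A zero ≡ A (suc zero)
    emptySides₁₃⇒A₀≡A₁ S₁≡∅ S₃≡∅ = subset-ext λ x →
      offSides₁₃⇒lookup₀≡lookup₁ (balance x) (emptySide⇒offSide S₁≡∅ x) (emptySide⇒offSide S₃≡∅ x)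

proposition7p6 : (n : ℕ) → n ≥ 1 → (A : Fin 4 → Subset n)
    → (∀ i j → i ≢ j → A i ≢ A j)
    → (∀ i → Nonempty (A i))
    → (∀ k → χ (A zero) k + χ (A (suc (suc zero))) k ≡ χ (A (suc zero)) k + χ (A (suc (suc (suc zero)))) k)
    → Nonempty (A zero ∩ A (suc zero))
    → Nonempty (A zero ∩ A (suc (suc zero)))
    → Nonempty (A (suc zero) ∩ A (suc (suc zero)))
    → (∀ i → i ≢ suc (suc (suc zero)) → weight (A i) < weight (A (suc (suc (suc zero)))))
    → (∀ i j → i ≢ j → Empty (S A i ∩ S A j))
      × (∀ i → Empty (M A ∩ S A i))
      × Nonempty (M A)
      × ¬ (Empty (S A zero) × Empty (S A (suc (suc zero))))
      × ¬ (Empty (S A (suc zero)) × Empty (S A (suc (suc (suc zero)))))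
proposition7p6 _ _ A distinct _ χ-balance _ A₀∩A₂≢∅ _ _ =
    (λ _ _ → S-disjoint A balance)
  , M-disjoint-S A
  , M-nonempty A balance A₀∩A₂≢∅
  , (λ (S₀≡∅ , S₂≡∅) → distinct zero (suc (suc (suc zero))) (λ ()) (emptySides₀₂⇒A₀≡A₃ A balance S₀≡∅ S₂≡∅))
  , (λ (S₁≡∅ , S₃≡∅) → distinct zero (suc zero) (λ ()) (emptySides₁₃⇒A₀≡A₁ A balance S₁≡∅ S₃≡∅))
  where
  balance : ∀ x → Balanced (column A x)
  balance x = balanced (column A x) (χ-balance x)
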